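{- Up to ${\sf IPC}$-provable equivalence, ${\sf NNIL}={\sf pNNIL}^\vee$ and ${\sf NNIL}({\sf par})={\sf pNNIL}({\sf par})^\vee$; that is, every ${\sf NNIL}$ formula (resp. ${\sf NNIL}({\sf par})$ formula) is ${\sf IPC}$-equivalent to a finite nonempty disjunction of ${\sf IPC}$-prime ${\sf NNIL}$ formulas (resp. ${\sf IPC}$-prime ${\sf NNIL}({\sf par})$ formulas), and conversely.
   Context: Propositional language with $\wedge,\vee,\to,\bot$ over a finite set of atoms ${\sf atom}={\sf var}\cup{\sf par}$ (variables and parameters). ${\sf NNIL}$ is the least class containing atoms, $\bot,\top$, closed under $\wedge,\vee$, and containing $B\to C$ whenever $C\in{\sf NNIL}$ and $B$ is built from atoms, $\bot,\top$ by $\wedge,\vee$ only. ${\sf NNIL}({\sf par})$ consists of the ${\sf NNIL}$ formulas all of whose atoms are parameters. A formula $E$ is ${\sf IPC}$-prime if ${\sf IPC}\vdash E\to(B\vee C)$ implies ${\sf IPC}\vdash E\to B$ or ${\sf IPC}\vdash E\to C$. ${\sf pNNIL}$ (resp. ${\sf pNNIL}({\sf par})$) is the set of ${\sf IPC}$-prime formulas in ${\sf NNIL}$ (resp. ${\sf NNIL}({\sf par})$). For a set $\Gamma$, $\Gamma^\vee$ is the set of disjunctions of finite nonempty subsets of $\Gamma$. -}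

module Defs where

open import Data.Nat using (ℕ)
open import Data.Fin using (Fin)
open import Data.Sum using (_⊎_; inj₁; inj₂)
open import Data.Product using (_×_; Σ; ∃; _,_)
open import Data.List using (List; []; _∷_)
open import Data.List.NonEmpty using (List⁺; foldr₁)
open import Data.List.Relation.Unary.All using (All)
open import Data.List.Membership.Propositional using (_∈_)

-- Atoms: nv variables and np parameters.  atom = var ∪ par.
Atom : ℕ → ℕ → Set
Atom nv np = Fin nv ⊎ Fin np

data IsPar {nv np : ℕ} : Atom nv np → Set where
  par : (p : Fin np) → IsPar (inj₂ p)

infixr 6 _∧'_
infixr 5 _∨'_
infixr 4 _⇒_

data Form (nv np : ℕ) : Set where
  atom : Atom nv np → Form nv np
  ⊥'   : Form nv np
  ⊤'   : Form nv np
  _∧'_ : Form nv np → Form nv np → Form nv np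
  _∨'_ : Form nv np → Form nv np → Form nv np
  _⇒_  : Form nv np → Form nv np → Form nv np

module _ {nv np : ℕ} where

  infix 2 _⊢_
  data _⊢_ (Γ : List (Form nv np)) : Form nv np → Set where
    hyp  : ∀ {A} → A ∈ Γ → Γ ⊢ A
    ⊤I   : Γ ⊢ ⊤'
    ⊥E   : ∀ {A} → Γ ⊢ ⊥' → Γ ⊢ A
    ∧I   : ∀ {A B} → Γ ⊢ A → Γ ⊢ B → Γ ⊢ A ∧' B
    ∧E₁  : ∀ {A B} → Γ ⊢ A ∧' B → Γ ⊢ A
    ∧E₂  : ∀ {A B} → Γ ⊢ A ∧' B → Γ ⊢ B
    ∨I₁  : ∀ {A B} → Γ ⊢ A → Γ ⊢ A ∨' B
    ∨I₂  : ∀ {A B} → Γ ⊢ B → Γ ⊢ A ∨' B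
    ∨E   : ∀ {A B C} → Γ ⊢ A ∨' B → (A ∷ Γ) ⊢ C → (B ∷ Γ) ⊢ C → Γ ⊢ C
    ⇒I   : ∀ {A B} → (A ∷ Γ) ⊢ B → Γ ⊢ A ⇒ B
    ⇒E   : ∀ {A B} → Γ ⊢ A ⇒ B → Γ ⊢ A → Γ ⊢ B

  IPC⊢ : Form nv np → Set
  IPC⊢ A = [] ⊢ A

  _≡IPC_ : Form nv np → Form nv np → Set
  A ≡IPC B = IPC⊢ (A ⇒ B) × IPC⊢ (B ⇒ A)

  data ImpFree : Form nv np → Set where
    atom : ∀ a → ImpFree (atom a)
    ⊥'   : ImpFree ⊥'
    ⊤'   : ImpFree ⊤'
    _∧'_ : ∀ {A B} → ImpFree A → ImpFree B → ImpFree (A ∧' B)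
    _∨'_ : ∀ {A B} → ImpFree A → ImpFree B → ImpFree (A ∨' B)

  data NNIL : Form nv np → Set where
    atom : ∀ a → NNIL (atom a)
    ⊥'   : NNIL ⊥'
    ⊤'   : NNIL ⊤'
    _∧'_ : ∀ {A B} → NNIL A → NNIL B → NNIL (A ∧' B)
    _∨'_ : ∀ {A B} → NNIL A → NNIL B → NNIL (A ∨' B)
    _⇒_  : ∀ {B C} → ImpFree B → NNIL C → NNIL (B ⇒ C)

  data ParOnly : Form nv np → Set where
    atom : ∀ {a} → IsPar a → ParOnly (atom a)
    ⊥'   : ParOnly ⊥'
    ⊤'   : ParOnly ⊤'
    _∧'_ : ∀ {A B} → ParOnly A → ParOnly B → ParOnly (A ∧' B)
    _∨'_ : ∀ {A B} → ParOnly A → ParOnly B → ParOnly (A ∨' B)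
    _⇒_  : ∀ {A B} → ParOnly A → ParOnly B → ParOnly (A ⇒ B)

  NNILpar : Form nv np → Set
  NNILpar A = NNIL A × ParOnly A

  Prime : Form nv np → Set
  Prime E = ∀ B C → IPC⊢ (E ⇒ (B ∨' C)) → IPC⊢ (E ⇒ B) ⊎ IPC⊢ (E ⇒ C)

  pNNIL : Form nv np → Set
  pNNIL A = NNIL A × Prime A

  pNNILpar : Form nv np → Set
  pNNILpar A = NNILpar A × Prime A

  ⋁ : List⁺ (Form nv np) → Form nv np
  ⋁ = foldr₁ _∨'_

{-# OPTIONS --safe #-}
-- Read an NNIL formula as a context of hypotheses and saturate it: split conjunctions, branch on
-- disjunctions, close a branch at ⊥, and replace an implication B → C by C once its
-- implication-free antecedent B is true under the atoms present (B is then derivable).  The total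
-- size drops at each step, and a saturated context consists of atoms and implications whose
-- antecedents are false under those atoms.  Its conjunction slashes itself in Aczel's sense, since
-- a slashed antecedent would be derivable and hence true under the atoms; so it is prime.  The
-- outputs are conjunctions of subformulas, so only parameters occur in them if only parameters
-- occur in the input.  The converse inclusion holds because NNIL is closed under ∨.
module Submission where

open import Defs
open import Data.Nat using (ℕ; suc; _+_; _<_; s≤s)
open import Data.Nat.Properties using (+-assoc; ≤-refl; ≤-reflexive; +-monoˡ-≤; m≤m+n; m≤n+m)
open import Data.Nat.ListAction using (sum)
open import Data.Nat.ListAction.Properties using (sum-↭)
open import Data.Nat.Induction using (<-wellFounded)
open import Induction.WellFounded using (Acc; acc)
import Data.Fin.Properties as Fin
open import Data.Sum using (_⊎_; inj₁; inj₂; [_,_])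
import Data.Sum.Properties as Sum
open import Data.Product using (_×_; Σ; ∃; _,_; proj₁; proj₂)
open import Data.List using (List; []; _∷_; _++_; map)
open import Data.List.NonEmpty using (List⁺; _∷_; toList; _⁺++⁺_)
open import Data.List.Relation.Unary.All using (All; []; _∷_; lookup; tabulate) renaming (map to all-map)
open import Data.List.Relation.Unary.All.Properties using (++⁺)
open import Data.List.Relation.Unary.Any using (Any; here; there)
open import Data.List.Membership.Propositional using (_∈_; find)
open import Data.List.Membership.Propositional.Properties using (∈-++⁺ˡ; ∈-++⁺ʳ; ∈-∃++)
import Data.List.Membership.DecPropositional as DecMembership
open import Data.List.Relation.Binary.Subset.Propositional using (_⊆_)
open import Data.List.Relation.Binary.Subset.Propositional.Properties using (∷⁺ʳ; ⊆-reflexive-↭)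
open import Data.List.Relation.Binary.Permutation.Propositional using (_↭_; ↭-sym)
open import Data.List.Relation.Binary.Permutation.Propositional.Properties using (shift; map⁺; All-resp-↭)
open import Data.Empty using (⊥; ⊥-elim)
open import Data.Unit using (⊤; tt)
open import Relation.Nullary using (¬_; Dec; yes; no)
open import Relation.Nullary.Decidable using (_×-dec_; _⊎-dec_; _→-dec_)
open import Function using (_∘_)
open import Relation.Binary.PropositionalEquality using (_≡_; refl; sym; subst)

private
  variable
    nv np : ℕ
    Γ Δ : List (Form nv np)
    A B C X : Form nv np

infix 2 _⊩_
_⊩_ : List (Form nv np) → List (Form nv np) → Set
Δ ⊩ Γ = All (Δ ⊢_) Γ

weaken : Γ ⊆ Δ → Γ ⊢ A → Δ ⊢ A
weaken ρ (hyp x) = hyp (ρ x)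
weaken ρ ⊤I = ⊤I
weaken ρ (⊥E d) = ⊥E (weaken ρ d)
weaken ρ (∧I d e) = ∧I (weaken ρ d) (weaken ρ e)
weaken ρ (∧E₁ d) = ∧E₁ (weaken ρ d)
weaken ρ (∧E₂ d) = ∧E₂ (weaken ρ d)
weaken ρ (∨I₁ d) = ∨I₁ (weaken ρ d)
weaken ρ (∨I₂ d) = ∨I₂ (weaken ρ d)
weaken ρ (∨E d e f) = ∨E (weaken ρ d) (weaken (∷⁺ʳ _ ρ) e) (weaken (∷⁺ʳ _ ρ) f)
weaken ρ (⇒I d) = ⇒I (weaken (∷⁺ʳ _ ρ) d)
weaken ρ (⇒E d e) = ⇒E (weaken ρ d) (weaken ρ e)

⊆⇒⊩ : Γ ⊆ Δ → Δ ⊩ Γ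
⊆⇒⊩ ρ = tabulate (λ x → hyp (ρ x))

⊩-refl : Γ ⊩ Γ
⊩-refl = ⊆⇒⊩ (λ x → x)

⊩-∷ : Δ ⊩ Γ → A ∷ Δ ⊩ A ∷ Γ
⊩-∷ σ = hyp (here refl) ∷ all-map (weaken there) σ

subst-⊢ : Δ ⊩ Γ → Γ ⊢ A → Δ ⊢ A
subst-⊢ σ (hyp x) = lookup σ x
subst-⊢ σ ⊤I = ⊤I
subst-⊢ σ (⊥E d) = ⊥E (subst-⊢ σ d)
subst-⊢ σ (∧I d e) = ∧I (subst-⊢ σ d) (subst-⊢ σ e)
subst-⊢ σ (∧E₁ d) = ∧E₁ (subst-⊢ σ d)
subst-⊢ σ (∧E₂ d) = ∧E₂ (subst-⊢ σ d)
subst-⊢ σ (∨I₁ d) = ∨I₁ (subst-⊢ σ d)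
subst-⊢ σ (∨I₂ d) = ∨I₂ (subst-⊢ σ d)
subst-⊢ σ (∨E d e f) = ∨E (subst-⊢ σ d) (subst-⊢ (⊩-∷ σ) e) (subst-⊢ (⊩-∷ σ) f)
subst-⊢ σ (⇒I d) = ⇒I (subst-⊢ (⊩-∷ σ) d)
subst-⊢ σ (⇒E d e) = ⇒E (subst-⊢ σ d) (subst-⊢ σ e)

⊩-trans : {Θ : List (Form nv np)} → Θ ⊩ Δ → Δ ⊩ Γ → Θ ⊩ Γ
⊩-trans σ τ = all-map (subst-⊢ σ) τ

⋁-intro : ∀ (Ds : List⁺ (Form nv np)) {D} → D ∈ toList Ds → Γ ⊢ D → Γ ⊢ ⋁ Ds
⋁-intro (D ∷ []) (here refl) d = d
⋁-intro (D ∷ _ ∷ _) (here refl) d = ∨I₁ d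
⋁-intro (_ ∷ D′ ∷ Ds) (there p) d = ∨I₂ (⋁-intro (D′ ∷ Ds) p d)

⋁-elim : ∀ (Ds : List⁺ (Form nv np)) → Γ ⊢ ⋁ Ds → (∀ {D} → D ∈ toList Ds → D ∷ Γ ⊢ C) → Γ ⊢ C
⋁-elim (D ∷ Ds) = elim D Ds
  where
    elim : ∀ {Γ C} D Ds → Γ ⊢ ⋁ (D ∷ Ds) → (∀ {E} → E ∈ D ∷ Ds → E ∷ Γ ⊢ C) → Γ ⊢ C
    elim D [] d k = subst-⊢ (d ∷ ⊩-refl) (k (here refl))
    elim D (D′ ∷ Ds) d k =
      ∨E d (k (here refl)) (elim D′ Ds (hyp (here refl)) (λ p → weaken (∷⁺ʳ _ there) (k (there p))))

⋁-closed : {P : Form nv np → Set} → (∀ {A B} → P A → P B → P (A ∨' B)) →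
  ∀ Ds → All P (toList Ds) → P (⋁ Ds)
⋁-closed ∨-closed (D ∷ []) (p ∷ []) = p
⋁-closed ∨-closed (D ∷ D′ ∷ Ds) (p ∷ ps) = ∨-closed p (⋁-closed ∨-closed (D′ ∷ Ds) ps)

conj : List (Form nv np) → Form nv np
conj [] = ⊤'
conj (A ∷ Γ) = A ∧' conj Γ

conj-intro : Δ ⊩ Γ → Δ ⊢ conj Γ
conj-intro [] = ⊤I
conj-intro (d ∷ ds) = ∧I d (conj-intro ds)

conj-elim : Δ ⊢ conj Γ → Δ ⊩ Γ
conj-elim {Γ = []} d = []
conj-elim {Γ = _ ∷ _} d = ∧E₁ d ∷ conj-elim (∧E₂ d)

Val : List (Atom nv np) → Form nv np → Set
Val S (atom a) = a ∈ S
Val S ⊥' = ⊥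
Val S ⊤' = ⊤
Val S (A ∧' B) = Val S A × Val S B
Val S (A ∨' B) = Val S A ⊎ Val S B
Val S (A ⇒ B) = Val S A → Val S B

Val? : ∀ S (A : Form nv np) → Dec (Val S A)
Val? S (atom a) = a ∈? S
  where open DecMembership (Sum.≡-dec Fin._≟_ Fin._≟_)
Val? S ⊥' = no λ ()
Val? S ⊤' = yes tt
Val? S (A ∧' B) = Val? S A ×-dec Val? S B
Val? S (A ∨' B) = Val? S A ⊎-dec Val? S B
Val? S (A ⇒ B) = Val? S A →-dec Val? S B

val-conj : ∀ {S} → All (Val S) Γ → Val S (conj Γ)
val-conj [] = tt
val-conj (v ∷ vs) = v , val-conj vs

val-sound : ∀ {S} → Γ ⊢ A → All (Val S) Γ → Val S A
val-sound (hyp x) ρ = lookup ρ x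
val-sound ⊤I ρ = tt
val-sound (⊥E d) ρ = ⊥-elim (val-sound d ρ)
val-sound (∧I d e) ρ = val-sound d ρ , val-sound e ρ
val-sound (∧E₁ d) ρ = proj₁ (val-sound d ρ)
val-sound (∧E₂ d) ρ = proj₂ (val-sound d ρ)
val-sound (∨I₁ d) ρ = inj₁ (val-sound d ρ)
val-sound (∨I₂ d) ρ = inj₂ (val-sound d ρ)
val-sound (∨E d e f) ρ = [ (λ a → val-sound e (a ∷ ρ)) , (λ b → val-sound f (b ∷ ρ)) ] (val-sound d ρ)
val-sound (⇒I d) ρ = λ a → val-sound d (a ∷ ρ)
val-sound (⇒E d e) ρ = val-sound d ρ (val-sound e ρ)

impFree-true⇒⊢ : ∀ {S} → (∀ {a} → a ∈ S → Γ ⊢ atom a) → ImpFree A → Val S A → Γ ⊢ A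
impFree-true⇒⊢ at (atom a) v = at v
impFree-true⇒⊢ at ⊤' v = ⊤I
impFree-true⇒⊢ at (i ∧' j) (v , w) = ∧I (impFree-true⇒⊢ at i v) (impFree-true⇒⊢ at j w)
impFree-true⇒⊢ at (i ∨' j) (inj₁ v) = ∨I₁ (impFree-true⇒⊢ at i v)
impFree-true⇒⊢ at (i ∨' j) (inj₂ w) = ∨I₂ (impFree-true⇒⊢ at j w)

module Slash (E : Form nv np) where

  infix 3 E∣_
  E∣_ : Form nv np → Set
  E∣ atom a = E ∷ [] ⊢ atom a
  E∣ ⊥' = ⊥
  E∣ ⊤' = ⊤
  E∣ (A ∧' B) = (E∣ A) × (E∣ B)
  E∣ (A ∨' B) = (E∣ A) ⊎ (E∣ B)
  E∣ (A ⇒ B) = (E ∷ [] ⊢ A ⇒ B) × (E∣ A → E∣ B)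

  slash⇒⊢ : ∀ A → E∣ A → E ∷ [] ⊢ A
  slash⇒⊢ (atom a) s = s
  slash⇒⊢ ⊤' _ = ⊤I
  slash⇒⊢ (A ∧' B) (s , t) = ∧I (slash⇒⊢ A s) (slash⇒⊢ B t)
  slash⇒⊢ (A ∨' B) (inj₁ s) = ∨I₁ (slash⇒⊢ A s)
  slash⇒⊢ (A ∨' B) (inj₂ t) = ∨I₂ (slash⇒⊢ B t)
  slash⇒⊢ (A ⇒ B) (d , _) = d

  slash-sound : Γ ⊢ A → All E∣_ Γ → E∣ A
  slash-sound (hyp x) ρ = lookup ρ x
  slash-sound ⊤I ρ = tt
  slash-sound (⊥E d) ρ = ⊥-elim (slash-sound d ρ)
  slash-sound (∧I d e) ρ = slash-sound d ρ , slash-sound e ρ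
  slash-sound (∧E₁ d) ρ = proj₁ (slash-sound d ρ)
  slash-sound (∧E₂ d) ρ = proj₂ (slash-sound d ρ)
  slash-sound (∨I₁ d) ρ = inj₁ (slash-sound d ρ)
  slash-sound (∨I₂ d) ρ = inj₂ (slash-sound d ρ)
  slash-sound (∨E d e f) ρ =
    [ (λ s → slash-sound e (s ∷ ρ)) , (λ s → slash-sound f (s ∷ ρ)) ] (slash-sound d ρ)
  slash-sound (⇒I d) ρ = subst-⊢ (all-map (slash⇒⊢ _) ρ) (⇒I d) , λ s → slash-sound d (s ∷ ρ)
  slash-sound (⇒E d e) ρ = proj₂ (slash-sound d ρ) (slash-sound e ρ)

  self-slashing⇒Prime : E∣ E → Prime E
  self-slashing⇒Prime s B C d =
    [ (λ b → inj₁ (⇒I (slash⇒⊢ B b))) , (λ c → inj₂ (⇒I (slash⇒⊢ C c))) ]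
      (slash-sound (⇒E (weaken (λ ()) d) (hyp (here refl))) (s ∷ []))

⊥-prime : Prime {nv} {np} ⊥'
⊥-prime B C d = inj₁ (⇒I (⊥E (hyp (here refl))))

data Irreducible (S : List (Atom nv np)) : Form nv np → Set where
  atom : ∀ a → Irreducible S (atom a)
  refuted⇒ : ¬ Val S B → Irreducible S (B ⇒ C)

conj-prime : ∀ {S} → Val S (conj Γ) → All (Irreducible S) Γ → Prime (conj Γ)
conj-prime {Γ = Γ} {S = S} true irr = self-slashing⇒Prime (slashes irr (conj-elim (hyp (here refl))))
  where
    open Slash (conj Γ)
    slashes : ∀ {Δ} → All (Irreducible S) Δ → conj Γ ∷ [] ⊩ Δ → E∣ conj Δ
    slashes [] [] = tt
    slashes (atom a ∷ irr) (d ∷ ds) = d , slashes irr ds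
    slashes (refuted⇒ {B} false ∷ irr) (d ∷ ds) =
      (d , λ s → ⊥-elim (false (val-sound (slash⇒⊢ B s) (true ∷ [])))) , slashes irr ds

atoms : List (Form nv np) → List (Atom nv np)
atoms [] = []
atoms (atom a ∷ Γ) = a ∷ atoms Γ
atoms (⊥' ∷ Γ) = atoms Γ
atoms (⊤' ∷ Γ) = atoms Γ
atoms ((_ ∧' _) ∷ Γ) = atoms Γ
atoms ((_ ∨' _) ∷ Γ) = atoms Γ
atoms ((_ ⇒ _) ∷ Γ) = atoms Γ

∈-atoms⁺ : ∀ {a} → atom a ∈ Γ → a ∈ atoms Γ
∈-atoms⁺ (here refl) = here refl
∈-atoms⁺ {Γ = atom _ ∷ _} (there p) = there (∈-atoms⁺ p)
∈-atoms⁺ {Γ = ⊥' ∷ _} (there p) = ∈-atoms⁺ p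
∈-atoms⁺ {Γ = ⊤' ∷ _} (there p) = ∈-atoms⁺ p
∈-atoms⁺ {Γ = (_ ∧' _) ∷ _} (there p) = ∈-atoms⁺ p
∈-atoms⁺ {Γ = (_ ∨' _) ∷ _} (there p) = ∈-atoms⁺ p
∈-atoms⁺ {Γ = (_ ⇒ _) ∷ _} (there p) = ∈-atoms⁺ p

∈-atoms⁻ : ∀ {a} → a ∈ atoms Γ → atom a ∈ Γ
∈-atoms⁻ {Γ = atom _ ∷ _} (here refl) = here refl
∈-atoms⁻ {Γ = atom _ ∷ _} (there p) = there (∈-atoms⁻ p)
∈-atoms⁻ {Γ = ⊥' ∷ _} p = there (∈-atoms⁻ p)
∈-atoms⁻ {Γ = ⊤' ∷ _} p = there (∈-atoms⁻ p)
∈-atoms⁻ {Γ = (_ ∧' _) ∷ _} p = there (∈-atoms⁻ p)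
∈-atoms⁻ {Γ = (_ ∨' _) ∷ _} p = there (∈-atoms⁻ p)
∈-atoms⁻ {Γ = (_ ⇒ _) ∷ _} p = there (∈-atoms⁻ p)

atoms-satisfy-conj : All (Irreducible (atoms Γ)) Γ → Val (atoms Γ) (conj Γ)
atoms-satisfy-conj irr = val-conj (tabulate λ p → true (lookup irr p) p)
  where
    true : ∀ {Γ X} → Irreducible (atoms Γ) X → X ∈ Γ → Val (atoms Γ) X
    true (atom a) p = ∈-atoms⁺ p
    true (refuted⇒ false) _ v = ⊥-elim (false v)

data Reducible (S : List (Atom nv np)) : Form nv np → Set where
  ⊥' : Reducible S ⊥'
  ⊤' : Reducible S ⊤'
  _∧'_ : ∀ A B → Reducible S (A ∧' B)
  _∨'_ : ∀ A B → Reducible S (A ∨' B)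
  fired⇒ : Val S B → Reducible S (B ⇒ C)

irreducible⊎reducible : ∀ S (X : Form nv np) → Irreducible S X ⊎ Reducible S X
irreducible⊎reducible S (atom a) = inj₁ (atom a)
irreducible⊎reducible S ⊥' = inj₂ ⊥'
irreducible⊎reducible S ⊤' = inj₂ ⊤'
irreducible⊎reducible S (A ∧' B) = inj₂ (A ∧' B)
irreducible⊎reducible S (A ∨' B) = inj₂ (A ∨' B)
irreducible⊎reducible S (B ⇒ C) with Val? S B
... | yes v = inj₂ (fired⇒ v)
... | no v̸ = inj₁ (refuted⇒ v̸)

all-irreducible⊎any-reducible : ∀ S (Γ : List (Form nv np)) →
  All (Irreducible S) Γ ⊎ Any (Reducible S) Γ
all-irreducible⊎any-reducible S [] = inj₁ []
all-irreducible⊎any-reducible S (X ∷ Γ) with irreducible⊎reducible S X | all-irreducible⊎any-reducible S Γ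
... | inj₂ r | _ = inj₂ (here r)
... | inj₁ _ | inj₂ rs = inj₂ (there rs)
... | inj₁ i | inj₁ is = inj₁ (i ∷ is)

∈⇒↭∷ : X ∈ Γ → ∃ λ Δ → Γ ↭ X ∷ Δ
∈⇒↭∷ p with Γ₁ , Γ₂ , refl ← ∈-∃++ p = Γ₁ ++ Γ₂ , shift _ Γ₁ Γ₂

↭∷⇒∈ : Γ ↭ X ∷ Δ → X ∈ Γ
↭∷⇒∈ p = ⊆-reflexive-↭ (↭-sym p) (here refl)

size : Form nv np → ℕ
size (atom a) = 1
size ⊥' = 1
size ⊤' = 1
size (A ∧' B) = suc (size A + size B)
size (A ∨' B) = suc (size A + size B)
size (A ⇒ B) = suc (size A + size B)

weight : List (Form nv np) → ℕ
weight Γ = sum (map size Γ)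

weight-↭ : Γ ↭ Δ → weight Γ ≡ weight Δ
weight-↭ p = sum-↭ (map⁺ size p)

record SubformulaClosed (Q : Form nv np → Set) : Set where
  field
    ∧-left : Q (A ∧' B) → Q A
    ∧-right : Q (A ∧' B) → Q B
    ∨-left : Q (A ∨' B) → Q A
    ∨-right : Q (A ∨' B) → Q B
    ⇒-right : Q (A ⇒ B) → Q B
    ⊤-closed : Q ⊤'
    ∧-closed : Q A → Q B → Q (A ∧' B)

module Decomposition (Q : Form nv np → Set) (closed : SubformulaClosed Q) where
  open SubformulaClosed closed

  Admissible : Form nv np → Set
  Admissible X = NNIL X × Q X

  Component : List (Form nv np) → Form nv np → Set
  Component Γ D = Prime D × Admissible D × (D ∷ [] ⊩ Γ)

  Splitting : List (Form nv np) → Set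
  Splitting Γ = Σ (List⁺ (Form nv np)) λ Ds → (Γ ⊢ ⋁ Ds) × All (Component Γ) (toList Ds)

  splitting-resp : Γ ⊩ Δ → Δ ⊩ Γ → Splitting Δ → Splitting Γ
  splitting-resp σ τ (Ds , d , cs) =
    Ds , subst-⊢ σ d , all-map (λ (p , a , ρ) → p , a , ⊩-trans ρ τ) cs

  splitting-∨ : Splitting (A ∷ Γ) → Splitting (B ∷ Γ) → Splitting ((A ∨' B) ∷ Γ)
  splitting-∨ {A = A} {Γ = Γ} {B = B} (Ds , d , cs) (Es , e , ds) =
    Ds ⁺++⁺ Es ,
    ∨E (hyp (here refl)) (into Ds (∈-++⁺ˡ) d) (into Es (∈-++⁺ʳ (toList Ds)) e) ,
    ++⁺ (all-map (back ∨I₁) cs) (all-map (back ∨I₂) ds)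
    where
      into : ∀ {Y} Fs → (∀ {F} → F ∈ toList Fs → F ∈ toList (Ds ⁺++⁺ Es)) →
        Y ∷ Γ ⊢ ⋁ Fs → Y ∷ (A ∨' B) ∷ Γ ⊢ ⋁ (Ds ⁺++⁺ Es)
      into Fs inc f =
        ⋁-elim Fs (weaken (∷⁺ʳ _ there) f) (λ p → ⋁-intro (Ds ⁺++⁺ Es) (inc p) (hyp (here refl)))
      back : ∀ {Y D} → (∀ {Θ} → Θ ⊢ Y → Θ ⊢ A ∨' B) → Component (Y ∷ Γ) D → Component ((A ∨' B) ∷ Γ) D
      back inj (p , a , y ∷ ρ) = p , a , inj y ∷ ρ

  splitting-rewrite : ∀ Xs → Γ ↭ X ∷ Δ → Γ ⊩ Xs → Xs ++ Δ ⊢ X → Splitting (Xs ++ Δ) → Splitting Γ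
  splitting-rewrite {Γ = Γ} {X = X} {Δ = Δ} Xs p to from = splitting-resp
    (++⁺ to (⊆⇒⊩ (λ q → ⊆-reflexive-↭ (↭-sym p) (there q))))
    (tabulate λ q → back (⊆-reflexive-↭ p q))
    where
      back : ∀ {Y} → Y ∈ X ∷ Δ → Xs ++ Δ ⊢ Y
      back (here refl) = from
      back (there q) = hyp (∈-++⁺ʳ Xs q)

  splitting-⊥ : Q ⊥' → ⊥' ∈ Γ → Splitting Γ
  splitting-⊥ q p = ⊥' ∷ [] , hyp p , (⊥-prime , (⊥' , q) , tabulate (λ _ → ⊥E (hyp (here refl)))) ∷ []

  splitting-irreducible : All Admissible Γ → All (Irreducible (atoms Γ)) Γ → Splitting Γ
  splitting-irreducible {Γ = Γ} adm irr =
    conj Γ ∷ [] , conj-intro ⊩-refl ,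
    (conj-prime (atoms-satisfy-conj irr) irr , admissible adm , conj-elim (hyp (here refl))) ∷ []
    where
      admissible : ∀ {Δ} → All Admissible Δ → Admissible (conj Δ)
      admissible [] = ⊤' , ⊤-closed
      admissible ((n , q) ∷ adm) with n′ , q′ ← admissible adm = n ∧' n′ , ∧-closed q q′

  splitting-step : ∀ {Γ X Δ} → Γ ↭ X ∷ Δ →
    (∀ Γ′ → weight Γ′ < size X + weight Δ → All Admissible Γ′ → Splitting Γ′) →
    All Admissible (X ∷ Δ) → Reducible (atoms Γ) X → Splitting Γ
  splitting-step p rec ((_ , q) ∷ admΔ) ⊥' = splitting-⊥ q (↭∷⇒∈ p)
  splitting-step p rec (_ ∷ admΔ) ⊤' = splitting-rewrite [] p [] ⊤I (rec _ ≤-refl admΔ)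
  splitting-step p rec ((nA ∧' nB , q) ∷ admΔ) (A ∧' B) =
    splitting-rewrite (A ∷ B ∷ []) p (∧E₁ (hyp (↭∷⇒∈ p)) ∷ ∧E₂ (hyp (↭∷⇒∈ p)) ∷ [])
      (∧I (hyp (here refl)) (hyp (there (here refl))))
      (rec (A ∷ B ∷ _) (s≤s (≤-reflexive (sym (+-assoc (size A) (size B) _))))
        ((nA , ∧-left q) ∷ (nB , ∧-right q) ∷ admΔ))
  splitting-step p rec ((nA ∨' nB , q) ∷ admΔ) (A ∨' B) =
    splitting-rewrite (_ ∷ []) p (hyp (↭∷⇒∈ p) ∷ []) (hyp (here refl)) (splitting-∨
      (rec (A ∷ _) (s≤s (+-monoˡ-≤ _ (m≤m+n (size A) (size B)))) ((nA , ∨-left q) ∷ admΔ))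
      (rec (B ∷ _) (s≤s (+-monoˡ-≤ _ (m≤n+m (size B) (size A)))) ((nB , ∨-right q) ∷ admΔ)))
  splitting-step p rec ((_⇒_ {B} {C} iB nC , q) ∷ admΔ) (fired⇒ v) =
    splitting-rewrite (C ∷ []) p (⇒E (hyp (↭∷⇒∈ p)) (impFree-true⇒⊢ (λ a → hyp (∈-atoms⁻ a)) iB v) ∷ [])
      (⇒I (hyp (there (here refl))))
      (rec (C ∷ _) (s≤s (+-monoˡ-≤ _ (m≤n+m (size C) (size B)))) ((nC , ⇒-right q) ∷ admΔ))

  splitting-acc : ∀ Γ → Acc _<_ (weight Γ) → All Admissible Γ → Splitting Γ
  splitting-acc Γ (acc rs) adm with all-irreducible⊎any-reducible (atoms Γ) Γ
  ... | inj₁ irr = splitting-irreducible adm irr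
  ... | inj₂ any with X , X∈Γ , r ← find any with Δ , p ← ∈⇒↭∷ X∈Γ =
    splitting-step p
      (λ Γ′ lt → splitting-acc Γ′ (rs (subst (weight Γ′ <_) (sym (weight-↭ p)) lt)))
      (All-resp-↭ p adm) r

  splitting : ∀ Γ → All Admissible Γ → Splitting Γ
  splitting Γ = splitting-acc Γ (<-wellFounded (weight Γ))

  decompose : Admissible A →
    Σ (List⁺ (Form nv np)) λ Ds → All (λ D → Prime D × Admissible D) (toList Ds) × (A ≡IPC ⋁ Ds)
  decompose {A = A} adm with Ds , d , cs ← splitting (A ∷ []) (adm ∷ []) =
    Ds , all-map (λ (p , a , _) → p , a) cs , ⇒I d ,
    ⇒I (⋁-elim Ds (hyp (here refl)) λ p → weaken (∷⁺ʳ _ λ ()) (lookup (proj₂ (proj₂ (lookup cs p))) (here refl)))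

≡IPC-refl : A ≡IPC A
≡IPC-refl = ⇒I (hyp (here refl)) , ⇒I (hyp (here refl))

everything-closed : SubformulaClosed {nv} {np} (λ _ → ⊤)
everything-closed = record
  { ∧-left = λ _ → tt ; ∧-right = λ _ → tt ; ∨-left = λ _ → tt ; ∨-right = λ _ → tt
  ; ⇒-right = λ _ → tt ; ⊤-closed = tt ; ∧-closed = λ _ _ → tt }

ParOnly-closed : SubformulaClosed {nv} {np} ParOnly
ParOnly-closed = record
  { ∧-left = λ { (p ∧' _) → p } ; ∧-right = λ { (_ ∧' q) → q }
  ; ∨-left = λ { (p ∨' _) → p } ; ∨-right = λ { (_ ∨' q) → q }
  ; ⇒-right = λ { (_ ⇒ q) → q } ; ⊤-closed = ⊤' ; ∧-closed = _∧'_ }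

corollary3p33 : (nv np : ℕ) →
    ((A : Form nv np) → NNIL A →
      Σ (List⁺ (Form nv np)) λ Ds → All pNNIL (toList Ds) × (A ≡IPC ⋁ Ds))
    × ((Ds : List⁺ (Form nv np)) → All pNNIL (toList Ds) →
      Σ (Form nv np) λ A → NNIL A × (A ≡IPC ⋁ Ds))
    × ((A : Form nv np) → NNILpar A →
      Σ (List⁺ (Form nv np)) λ Ds → All pNNILpar (toList Ds) × (A ≡IPC ⋁ Ds))
    × ((Ds : List⁺ (Form nv np)) → All pNNILpar (toList Ds) →
      Σ (Form nv np) λ A → NNILpar A × (A ≡IPC ⋁ Ds))
corollary3p33 nv np =
  (λ A nnil → let Ds , ps , eq = Decomposition.decompose _ everything-closed (nnil , tt)
              in Ds , all-map (λ (prime , nnil , _) → nnil , prime) ps , eq) ,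
  (λ Ds ps → ⋁ Ds , ⋁-closed _∨'_ Ds (all-map proj₁ ps) , ≡IPC-refl) ,
  (λ A nnilpar → let Ds , ps , eq = Decomposition.decompose _ ParOnly-closed nnilpar
                 in Ds , all-map (λ (prime , nnilpar) → nnilpar , prime) ps , eq) ,
  (λ Ds ps → ⋁ Ds ,
    (⋁-closed _∨'_ Ds (all-map (proj₁ ∘ proj₁) ps) , ⋁-closed _∨'_ Ds (all-map (proj₂ ∘ proj₁) ps)) ,
    ≡IPC-refl)
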